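{- Let $R=\mathcal{R}(d(t),t)$ with $d(t)=d_0+d_1t+d_2t^2+\cdots$, $d_0\neq0$. Then for every integer $m\ge0$, $$\mathrm{Der}^{2m}(R)=\mathcal{R}\Big(\sum_{i=0}^m S_{m+1,i+1}\,t^i d^{(i)}(t),\;t\Big)=\mathcal{R}\Big(\sum_{i\ge0}d_i(i+1)^mt^i,\;t\Big),$$ $$\mathrm{Der}^{2m+1}(R)=\mathcal{R}\Big(1,\;\sum_{i=0}^m S_{m+1,i+1}\,t^{i+1}d^{(i)}(t)\Big)=\mathcal{R}\Big(1,\;t\sum_{i\ge0}d_i(i+1)^mt^i\Big),$$ where $S_{m+1,i+1}$ is a Stirling number of the second kind and $d^{(i)}(t)$ is the $i$th derivative of $d(t)$.
   Context: For formal power series $d(t),h(t)$ with $d(0)\neq0$, $h(0)=0$, $h'(0)\neq0$, $\mathcal{R}(d(t),h(t))$ is the infinite lower triangular matrix with $(n,k)$-entry $[t^n]\,d(t)h(t)^k$ ($n,k\ge0$). The operation $\mathrm{Der}$ is $\mathrm{Der}(\mathcal{R}(d(t),h(t)))=\mathcal{R}(h'(t),t\,d(t))$, and $\mathrm{Der}^k$ denotes $\mathrm{Der}$ iterated $k$ times ($\mathrm{Der}^0$ is the identity). -}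

module Defs where

open import Level using (Level)
open import Data.Nat using (ℕ; zero; suc; _∸_)
open import Data.Product using (_×_; _,_)
open import Algebra.Bundles using (CommutativeRing)

stirling₂ : ℕ → ℕ → ℕ
stirling₂ zero    zero    = 1
stirling₂ zero    (suc k) = 0
stirling₂ (suc n) zero    = 0
stirling₂ (suc n) (suc k) = suc k Data.Nat.* stirling₂ n (suc k) Data.Nat.+ stirling₂ n k

module FPS {c ℓ : Level} (R : CommutativeRing c ℓ) where
  open CommutativeRing R hiding (_≈_; 0#; 1#)
  open CommutativeRing R public using (_≈_; 0#; 1#) renaming (_*_ to _*R_)

  Series : Set c
  Series = ℕ → Carrier

  fromℕ : ℕ → Carrier
  fromℕ zero    = 0#
  fromℕ (suc n) = 1# + fromℕ n

  sumTo : ℕ → (ℕ → Carrier) → Carrier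
  sumTo zero    f = 0#
  sumTo (suc n) f = sumTo n f + f n

  coeff : ℕ → Series → Carrier
  coeff n f = f n

  zeroS : Series
  zeroS _ = 0#

  oneS : Series
  oneS zero    = 1#
  oneS (suc _) = 0#

  tS : Series
  tS (suc zero) = 1#
  tS _          = 0#

  _⊕_ : Series → Series → Series
  (f ⊕ g) n = f n + g n

  _⊛_ : Series → Series → Series
  (f ⊛ g) n = sumTo (suc n) (λ i → f i * g (n ∸ i))

  _·_ : Carrier → Series → Series
  (a · f) n = a * f n

  _^S_ : Series → ℕ → Series
  f ^S zero    = oneS
  f ^S (suc k) = f ⊛ (f ^S k)

  deriv : Series → Series
  deriv f n = fromℕ (suc n) * f (suc n)

  deriv^ : ℕ → Series → Series
  deriv^ zero    f = f
  deriv^ (suc i) f = deriv (deriv^ i f)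

  sumS : ℕ → (ℕ → Series) → Series
  sumS m F n = sumTo (suc m) (λ i → F i n)

  Riordan : Series → Series → ℕ → ℕ → Carrier
  Riordan d h n k = coeff n (d ⊛ (h ^S k))

  _≋_ : (ℕ → ℕ → Carrier) → (ℕ → ℕ → Carrier) → Set ℓ
  A ≋ B = ∀ n k → A n k ≈ B n k

  -- Der acting on the defining pair: R(d,h) ↦ R(h', t d)
  Der : Series × Series → Series × Series
  Der (d , h) = (deriv h , tS ⊛ d)

  Der^ : ℕ → Series × Series → Series × Series
  Der^ zero    p = p
  Der^ (suc k) p = Der (Der^ k p)

  RiordanP : Series × Series → ℕ → ℕ → Carrier
  RiordanP (d , h) = Riordan d h

-- Since Der (a , t) = (1 , t a) and Der (1 , t a) = ((t a)′ , t), where (t a)′ has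
-- coefficients (n + 1) aₙ, induction gives Der^{2m} (d , t) = (Σ dₙ (n + 1)^m tⁿ , t),
-- and one more step gives Der^{2m+1} (d , t) = (1 , t Σ dₙ (n + 1)^m tⁿ). The Stirling
-- forms reduce to these coefficientwise: [tⁿ] tⁱ d⁽ⁱ⁾ = n (n − 1) ⋯ (n − i + 1) dₙ, and
-- (n + 1)^m = Σᵢ S(m + 1 , i + 1) n (n − 1) ⋯ (n − i + 1).
module Submission where

open import Defs
open import Level using (Level)
open import Data.Nat using (ℕ; zero; suc; _^_; _+_; _*_; _∸_; _<_; s≤s)
import Data.Nat.Properties as ℕₚ
import Algebra.Properties.CommutativeSemigroup as CommSemigroupProperties
open import Data.Nat.Solver using (module +-*-Solver)
open import Data.Product using (_×_; _,_)
open import Data.Product.Relation.Binary.Pointwise.NonDependent using (×-setoid)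
open import Relation.Nullary using (¬_)
open import Relation.Binary.Bundles using (Setoid)
import Relation.Binary.Reasoning.Setoid as SetoidReasoning
open import Algebra.Bundles using (CommutativeRing)
import Relation.Binary.PropositionalEquality as ≡
open ≡ using (_≡_)

infixl 8 _↓_

_↓_ : ℕ → ℕ → ℕ
n     ↓ zero  = 1
zero  ↓ suc i = 0
suc n ↓ suc i = suc n * n ↓ i

↓-step : ∀ n i → suc i * n ↓ i + n ↓ suc i ≡ suc n * n ↓ i
↓-step zero    zero    = ≡.refl
↓-step (suc n) zero    = ≡.refl
↓-step zero    (suc i) = ≡.trans (ℕₚ.+-identityʳ _) (ℕₚ.*-zeroʳ (suc (suc i)))
↓-step (suc n) (suc i) = begin
    suc (suc i) * (suc n * a) + suc n * b
  ≡⟨ solve 4 (λ n i a b → (con 2 :+ i) :* ((con 1 :+ n) :* a) :+ (con 1 :+ n) :* b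
                       := (con 1 :+ n) :* (a :+ ((con 1 :+ i) :* a :+ b))) ≡.refl n i a b ⟩
    suc n * (a + (suc i * a + b))
  ≡⟨ ≡.cong (λ x → suc n * (a + x)) (↓-step n i) ⟩
    suc n * (a + suc n * a)
  ≡⟨ solve 2 (λ n a → (con 1 :+ n) :* (a :+ (con 1 :+ n) :* a)
                   := (con 2 :+ n) :* ((con 1 :+ n) :* a)) ≡.refl n a ⟩
    suc (suc n) * (suc n * a) ∎
  where
  open ≡.≡-Reasoning
  open +-*-Solver
  a b : ℕ
  a = n ↓ i
  b = n ↓ suc i

sumℕ : ℕ → (ℕ → ℕ) → ℕ
sumℕ zero    f = 0
sumℕ (suc n) f = sumℕ n f + f n

sumℕ-cong : ∀ n {f g : ℕ → ℕ} → (∀ i → f i ≡ g i) → sumℕ n f ≡ sumℕ n g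
sumℕ-cong zero    f≡g = ≡.refl
sumℕ-cong (suc n) f≡g = ≡.cong₂ _+_ (sumℕ-cong n f≡g) (f≡g n)

sumℕ-sucˡ : ∀ n f → sumℕ (suc n) f ≡ f 0 + sumℕ n (λ i → f (suc i))
sumℕ-sucˡ zero    f = ℕₚ.+-comm 0 (f 0)
sumℕ-sucˡ (suc n) f = ≡.trans (≡.cong (_+ f (suc n)) (sumℕ-sucˡ n f)) (ℕₚ.+-assoc (f 0) _ _)

sumℕ-+ : ∀ n f g → sumℕ n (λ i → f i + g i) ≡ sumℕ n f + sumℕ n g
sumℕ-+ zero    f g = ≡.refl
sumℕ-+ (suc n) f g = ≡.trans (≡.cong (_+ (f n + g n)) (sumℕ-+ n f g))
  (CommSemigroupProperties.interchange ℕₚ.+-commutativeSemigroup (sumℕ n f) (sumℕ n g) (f n) (g n))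

sumℕ-*ˡ : ∀ n c f → sumℕ n (λ i → c * f i) ≡ c * sumℕ n f
sumℕ-*ˡ zero    c f = ≡.sym (ℕₚ.*-zeroʳ c)
sumℕ-*ˡ (suc n) c f = ≡.trans (≡.cong (_+ c * f n) (sumℕ-*ˡ n c f)) (≡.sym (ℕₚ.*-distribˡ-+ c _ _))

stirling₂-< : ∀ {n k} → n < k → stirling₂ n k ≡ 0
stirling₂-< {zero}  {suc k} _ = ≡.refl
stirling₂-< {suc n} {suc k} (s≤s n<k)
  rewrite stirling₂-< (ℕₚ.m<n⇒m<1+n n<k) | stirling₂-< n<k = ≡.trans (ℕₚ.+-identityʳ _) (ℕₚ.*-zeroʳ (suc k))

-- Summation by parts against the recurrence S(m + 2, i + 1) = (i + 1) S(m + 1, i + 1) + S(m + 1, i).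
stirling₂-sum-suc : ∀ m (f : ℕ → ℕ) →
  sumℕ (suc (suc m)) (λ i → stirling₂ (suc (suc m)) (suc i) * f i)
    ≡ sumℕ (suc m) (λ i → stirling₂ (suc m) (suc i) * (suc i * f i + f (suc i)))
stirling₂-sum-suc m f = begin
    sumℕ (suc (suc m)) (λ i → (suc i * S (suc i) + S i) * f i)
  ≡⟨ sumℕ-cong (suc (suc m)) (λ i → solve 4 (λ i s s′ x → ((con 1 :+ i) :* s :+ s′) :* x
                                             := s :* ((con 1 :+ i) :* x) :+ s′ :* x)
                                             ≡.refl i (S (suc i)) (S i) (f i)) ⟩
    sumℕ (suc (suc m)) (λ i → S (suc i) * (suc i * f i) + S i * f i)
  ≡⟨ sumℕ-+ (suc (suc m)) _ _ ⟩
    (A + S (suc (suc m)) * (suc (suc m) * f (suc m))) + sumℕ (suc (suc m)) (λ i → S i * f i)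
  ≡⟨ ≡.cong₂ _+_ drop-last (sumℕ-sucˡ (suc m) _) ⟩
    A + sumℕ (suc m) (λ i → S (suc i) * f (suc i))
  ≡⟨ sumℕ-+ (suc m) _ _ ⟨
    sumℕ (suc m) (λ i → S (suc i) * (suc i * f i) + S (suc i) * f (suc i))
  ≡⟨ sumℕ-cong (suc m) (λ i → ℕₚ.*-distribˡ-+ (S (suc i)) _ _) ⟨
    sumℕ (suc m) (λ i → S (suc i) * (suc i * f i + f (suc i))) ∎
  where
  open ≡.≡-Reasoning
  open +-*-Solver
  S : ℕ → ℕ
  S = stirling₂ (suc m)
  A : ℕ
  A = sumℕ (suc m) (λ i → S (suc i) * (suc i * f i))
  drop-last : A + S (suc (suc m)) * (suc (suc m) * f (suc m)) ≡ A
  drop-last = ≡.trans (≡.cong (λ s → A + s * (suc (suc m) * f (suc m))) (stirling₂-< (ℕₚ.n<1+n (suc m))))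
                      (ℕₚ.+-identityʳ A)

stirling₂-falling : ∀ m n → sumℕ (suc m) (λ i → stirling₂ (suc m) (suc i) * n ↓ i) ≡ suc n ^ m
stirling₂-falling zero    n = ≡.refl
stirling₂-falling (suc m) n = begin
    sumℕ (suc (suc m)) (λ i → stirling₂ (suc (suc m)) (suc i) * n ↓ i)
  ≡⟨ stirling₂-sum-suc m (n ↓_) ⟩
    sumℕ (suc m) (λ i → S (suc i) * (suc i * n ↓ i + n ↓ suc i))
  ≡⟨ sumℕ-cong (suc m) (λ i → ≡.cong (S (suc i) *_) (↓-step n i)) ⟩
    sumℕ (suc m) (λ i → S (suc i) * (suc n * n ↓ i))
  ≡⟨ sumℕ-cong (suc m) (λ i → CommSemigroupProperties.x∙yz≈y∙xz ℕₚ.*-commutativeSemigroup (S (suc i)) (suc n) _) ⟩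
    sumℕ (suc m) (λ i → suc n * (S (suc i) * n ↓ i))
  ≡⟨ sumℕ-*ˡ (suc m) (suc n) _ ⟩
    suc n * sumℕ (suc m) (λ i → S (suc i) * n ↓ i)
  ≡⟨ ≡.cong (suc n *_) (stirling₂-falling m n) ⟩
    suc n * suc n ^ m ∎
  where
  open ≡.≡-Reasoning
  S : ℕ → ℕ
  S = stirling₂ (suc m)

module FPSProperties {c ℓ : Level} (R : CommutativeRing c ℓ) where
  open CommutativeRing R hiding (_*_) renaming (_+_ to _+R_)
  open FPS R hiding (_≈_; 0#; 1#)
  open import Algebra.Properties.Semiring.Mult semiring using (×-homo-+; ×1-homo-*)
    renaming (_×_ to _×ℕ_)
  open CommSemigroupProperties *-commutativeSemigroup using (x∙yz≈y∙xz)

  fromℕ≈×1 : ∀ n → fromℕ n ≈ n ×ℕ 1#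
  fromℕ≈×1 zero    = refl
  fromℕ≈×1 (suc n) = +-congˡ (fromℕ≈×1 n)

  fromℕ-homo-+ : ∀ a b → fromℕ (a + b) ≈ fromℕ a +R fromℕ b
  fromℕ-homo-+ a b = begin
    fromℕ (a + b)       ≈⟨ fromℕ≈×1 (a + b) ⟩
    (a + b) ×ℕ 1#       ≈⟨ ×-homo-+ 1# a b ⟩
    a ×ℕ 1# +R b ×ℕ 1#  ≈⟨ +-cong (fromℕ≈×1 a) (fromℕ≈×1 b) ⟨
    fromℕ a +R fromℕ b  ∎
    where open SetoidReasoning setoid

  fromℕ-homo-* : ∀ a b → fromℕ (a * b) ≈ fromℕ a *R fromℕ b
  fromℕ-homo-* a b = begin
    fromℕ (a * b)           ≈⟨ fromℕ≈×1 (a * b) ⟩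
    (a * b) ×ℕ 1#           ≈⟨ ×1-homo-* a b ⟩
    (a ×ℕ 1#) *R (b ×ℕ 1#)  ≈⟨ *-cong (fromℕ≈×1 a) (fromℕ≈×1 b) ⟨
    fromℕ a *R fromℕ b      ∎
    where open SetoidReasoning setoid

  sumTo-cong : ∀ n {f g : ℕ → Carrier} → (∀ i → f i ≈ g i) → sumTo n f ≈ sumTo n g
  sumTo-cong zero    f≈g = refl
  sumTo-cong (suc n) f≈g = +-cong (sumTo-cong n f≈g) (f≈g n)

  fromℕ-homo-sum : ∀ n f → fromℕ (sumℕ n f) ≈ sumTo n (λ i → fromℕ (f i))
  fromℕ-homo-sum zero    f = refl
  fromℕ-homo-sum (suc n) f = trans (fromℕ-homo-+ (sumℕ n f) (f n)) (+-congʳ (fromℕ-homo-sum n f))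

  sumTo-sucˡ : ∀ n f → sumTo (suc n) f ≈ f 0 +R sumTo n (λ i → f (suc i))
  sumTo-sucˡ zero    f = +-comm _ _
  sumTo-sucˡ (suc n) f = trans (+-congʳ (sumTo-sucˡ n f)) (+-assoc _ _ _)

  sumTo-zero : ∀ n f → (∀ i → f i ≈ 0#) → sumTo n f ≈ 0#
  sumTo-zero zero    f f≈0 = refl
  sumTo-zero (suc n) f f≈0 = trans (+-cong (sumTo-zero n f f≈0) (f≈0 n)) (+-identityˡ 0#)

  sumTo-*ʳ : ∀ n f x → sumTo n f *R x ≈ sumTo n (λ i → f i *R x)
  sumTo-*ʳ zero    f x = zeroˡ x
  sumTo-*ʳ (suc n) f x = trans (distribʳ x _ _) (+-congʳ (sumTo-*ʳ n f x))

  infix 4 _≐_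

  _≐_ : Series → Series → Set ℓ
  f ≐ g = ∀ n → f n ≈ g n

  ≐-setoid : Setoid c ℓ
  ≐-setoid = record
    { Carrier       = Series
    ; _≈_           = _≐_
    ; isEquivalence = record
      { refl  = λ _ → refl
      ; sym   = λ f≐g n → sym (f≐g n)
      ; trans = λ f≐g g≐h n → trans (f≐g n) (g≐h n)
      }
    }

  ≐²-setoid : Setoid c ℓ
  ≐²-setoid = ×-setoid ≐-setoid ≐-setoid

  open Setoid ≐-setoid public using ()
    renaming (refl to ≐-refl; reflexive to ≐-reflexive; sym to ≐-sym; trans to ≐-trans)
  open Setoid ≐²-setoid public using () renaming (_≈_ to _≐²_; trans to ≐²-trans)

  ⊛-cong : ∀ {f f′ g g′} → f ≐ f′ → g ≐ g′ → f ⊛ g ≐ f′ ⊛ g′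
  ⊛-cong f≐f′ g≐g′ n = sumTo-cong (suc n) (λ i → *-cong (f≐f′ i) (g≐g′ (n ∸ i)))

  ⊛-congʳ : ∀ g {f f′} → f ≐ f′ → f ⊛ g ≐ f′ ⊛ g
  ⊛-congʳ g f≐f′ = ⊛-cong {g = g} f≐f′ (λ _ → refl)

  ^S-cong : ∀ {h h′} → h ≐ h′ → ∀ k → h ^S k ≐ h′ ^S k
  ^S-cong h≐h′ zero    = ≐-refl
  ^S-cong h≐h′ (suc k) = ⊛-cong h≐h′ (^S-cong h≐h′ k)

  Riordan-cong : ∀ {d d′ h h′} → d ≐ d′ → h ≐ h′ → Riordan d h ≋ Riordan d′ h′
  Riordan-cong d≐d′ h≐h′ n k = ⊛-cong d≐d′ (^S-cong h≐h′ k) n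

  RiordanP-cong : ∀ {p q} → p ≐² q → RiordanP p ≋ RiordanP q
  RiordanP-cong (d≐d′ , h≐h′) = Riordan-cong d≐d′ h≐h′

  deriv-cong : ∀ {f g} → f ≐ g → deriv f ≐ deriv g
  deriv-cong f≐g n = *-cong refl (f≐g (suc n))

  Der-cong : ∀ {p q} → p ≐² q → Der p ≐² Der q
  Der-cong (d≐d′ , h≐h′) = deriv-cong h≐h′ , ⊛-cong ≐-refl d≐d′

  shift : Series → Series
  shift f zero    = 0#
  shift f (suc n) = f n

  shift^ : ℕ → Series → Series
  shift^ zero    f = f
  shift^ (suc i) f = shift (shift^ i f)

  shift-cong : ∀ {f g} → f ≐ g → shift f ≐ shift g
  shift-cong f≐g zero    = refl
  shift-cong f≐g (suc n) = f≐g n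

  shift^-cong : ∀ i {f g} → f ≐ g → shift^ i f ≐ shift^ i g
  shift^-cong zero    f≐g = f≐g
  shift^-cong (suc i) f≐g = shift-cong (shift^-cong i f≐g)

  ⊛-identityˡ : ∀ g → oneS ⊛ g ≐ g
  ⊛-identityˡ g n = begin
    (oneS ⊛ g) n                                      ≈⟨ sumTo-sucˡ n _ ⟩
    1# *R g n +R sumTo n (λ i → 0# *R g (n ∸ suc i))  ≈⟨ +-cong (*-identityˡ _) (sumTo-zero n _ (λ _ → zeroˡ _)) ⟩
    g n +R 0#                                         ≈⟨ +-identityʳ _ ⟩
    g n                                               ∎
    where open SetoidReasoning setoid

  shift-⊛ : ∀ f g → shift f ⊛ g ≐ shift (f ⊛ g)
  shift-⊛ f g zero    = trans (+-identityˡ _) (zeroˡ _)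
  shift-⊛ f g (suc n) = trans (sumTo-sucˡ (suc n) _) (trans (+-congʳ (zeroˡ _)) (+-identityˡ _))

  shift^-⊛ : ∀ i f g → shift^ i f ⊛ g ≐ shift^ i (f ⊛ g)
  shift^-⊛ zero    f g = ≐-refl
  shift^-⊛ (suc i) f g = ≐-trans (shift-⊛ (shift^ i f) g) (shift-cong (shift^-⊛ i f g))

  tS≐shift-oneS : tS ≐ shift oneS
  tS≐shift-oneS zero          = refl
  tS≐shift-oneS (suc zero)    = refl
  tS≐shift-oneS (suc (suc n)) = refl

  tS-⊛ : ∀ f → tS ⊛ f ≐ shift f
  tS-⊛ f = ≐-trans (⊛-congʳ f tS≐shift-oneS) (≐-trans (shift-⊛ oneS f) (shift-cong (⊛-identityˡ f)))

  tS^≐shift^-oneS : ∀ i → tS ^S i ≐ shift^ i oneS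
  tS^≐shift^-oneS zero    = ≐-refl
  tS^≐shift^-oneS (suc i) = ≐-trans (⊛-cong ≐-refl (tS^≐shift^-oneS i)) (tS-⊛ (shift^ i oneS))

  tS^-⊛ : ∀ i f → (tS ^S i) ⊛ f ≐ shift^ i f
  tS^-⊛ i f = ≐-trans (⊛-congʳ f (tS^≐shift^-oneS i))
                     (≐-trans (shift^-⊛ i oneS f) (shift^-cong i (⊛-identityˡ f)))

  deriv^-suc : ∀ i f → deriv^ (suc i) f ≡ deriv^ i (deriv f)
  deriv^-suc zero    f = ≡.refl
  deriv^-suc (suc i) f = ≡.cong deriv (deriv^-suc i f)

  shift^-deriv^ : ∀ i f n → shift^ i (deriv^ i f) n ≈ fromℕ (n ↓ i) *R f n
  shift^-deriv^ zero    f n       = sym (trans (*-congʳ (+-identityʳ 1#)) (*-identityˡ (f n)))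
  shift^-deriv^ (suc i) f zero    = sym (zeroˡ (f 0))
  shift^-deriv^ (suc i) f (suc n) = begin
    shift^ i (deriv (deriv^ i f)) n                ≡⟨ ≡.cong (λ g → shift^ i g n) (deriv^-suc i f) ⟩
    shift^ i (deriv^ i (deriv f)) n                ≈⟨ shift^-deriv^ i (deriv f) n ⟩
    fromℕ (n ↓ i) *R (fromℕ (suc n) *R f (suc n))  ≈⟨ x∙yz≈y∙xz (fromℕ (n ↓ i)) (fromℕ (suc n)) (f (suc n)) ⟩
    fromℕ (suc n) *R (fromℕ (n ↓ i) *R f (suc n))  ≈⟨ *-assoc (fromℕ (suc n)) (fromℕ (n ↓ i)) (f (suc n)) ⟨
    fromℕ (suc n) *R fromℕ (n ↓ i) *R f (suc n)    ≈⟨ *-congʳ (fromℕ-homo-* (suc n) (n ↓ i)) ⟨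
    fromℕ (suc n * n ↓ i) *R f (suc n)             ∎
    where open SetoidReasoning setoid

  sumS-·-cong : ∀ m (a : ℕ → Carrier) {F G : ℕ → Series} →
                (∀ i → F i ≐ G i) → sumS m (λ i → a i · F i) ≐ sumS m (λ i → a i · G i)
  sumS-·-cong m a F≐G n = sumTo-cong (suc m) (λ i → *-congˡ (F≐G i n))

  sumS-·-shift : ∀ m (a : ℕ → Carrier) (F : ℕ → Series) →
                 sumS m (λ i → a i · shift (F i)) ≐ shift (sumS m (λ i → a i · F i))
  sumS-·-shift m a F zero    = sumTo-zero (suc m) _ (λ i → zeroʳ (a i))
  sumS-·-shift m a F (suc n) = refl

  stirlingCombination : ℕ → (ℕ → Series) → Series
  stirlingCombination m F = sumS m (λ i → fromℕ (stirling₂ (m + 1) (i + 1)) · F i)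

  powerWeighted : ℕ → Series → Series
  powerWeighted m d n = d n *R fromℕ (suc n ^ m)

  stirlingCombination-shift^-deriv^ : ∀ m d →
    stirlingCombination m (λ i → shift^ i (deriv^ i d)) ≐ powerWeighted m d
  stirlingCombination-shift^-deriv^ m d n = begin
    sumTo (suc m) (λ i → fromℕ (stirling₂ (m + 1) (i + 1)) *R shift^ i (deriv^ i d) n)
      ≈⟨ sumTo-cong (suc m) (λ i → *-cong (reflexive (≡.cong fromℕ (S-index i))) (shift^-deriv^ i d n)) ⟩
    sumTo (suc m) (λ i → fromℕ (S (suc i)) *R (fromℕ (n ↓ i) *R d n))
      ≈⟨ sumTo-cong (suc m) (λ i → trans (*-congʳ (fromℕ-homo-* (S (suc i)) (n ↓ i))) (*-assoc _ _ _)) ⟨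
    sumTo (suc m) (λ i → fromℕ (S (suc i) * n ↓ i) *R d n)
      ≈⟨ sumTo-*ʳ (suc m) _ (d n) ⟨
    sumTo (suc m) (λ i → fromℕ (S (suc i) * n ↓ i)) *R d n
      ≈⟨ *-congʳ (fromℕ-homo-sum (suc m) (λ i → S (suc i) * n ↓ i)) ⟨
    fromℕ (sumℕ (suc m) (λ i → S (suc i) * n ↓ i)) *R d n
      ≡⟨ ≡.cong (λ k → fromℕ k *R d n) (stirling₂-falling m n) ⟩
    fromℕ (suc n ^ m) *R d n
      ≈⟨ *-comm _ _ ⟩
    powerWeighted m d n ∎
    where
    open SetoidReasoning setoid
    S : ℕ → ℕ
    S = stirling₂ (suc m)
    S-index : ∀ i → stirling₂ (m + 1) (i + 1) ≡ S (suc i)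
    S-index i = ≡.cong₂ stirling₂ (ℕₚ.+-comm m 1) (ℕₚ.+-comm i 1)

  stirlingCombination-tS^ : ∀ m d →
    stirlingCombination m (λ i → (tS ^S i) ⊛ deriv^ i d) ≐ powerWeighted m d
  stirlingCombination-tS^ m d =
    ≐-trans (sumS-·-cong m _ (λ i → tS^-⊛ i (deriv^ i d))) (stirlingCombination-shift^-deriv^ m d)

  stirlingCombination-tS^-suc : ∀ m d →
    stirlingCombination m (λ i → (tS ^S (i + 1)) ⊛ deriv^ i d) ≐ tS ⊛ powerWeighted m d
  stirlingCombination-tS^-suc m d = begin
    stirlingCombination m (λ i → (tS ^S (i + 1)) ⊛ deriv^ i d)
      ≈⟨ sumS-·-cong m _ (λ i → ≐-trans (tS^-⊛ (i + 1) _) (≐-reflexive (shift^-+1 i))) ⟩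
    sumS m (λ i → _ · shift (shift^ i (deriv^ i d)))
      ≈⟨ sumS-·-shift m _ (λ i → shift^ i (deriv^ i d)) ⟩
    shift (stirlingCombination m (λ i → shift^ i (deriv^ i d)))
      ≈⟨ shift-cong (stirlingCombination-shift^-deriv^ m d) ⟩
    shift (powerWeighted m d)
      ≈⟨ tS-⊛ (powerWeighted m d) ⟨
    tS ⊛ powerWeighted m d ∎
    where
    open SetoidReasoning ≐-setoid
    shift^-+1 : ∀ i → shift^ (i + 1) (deriv^ i d) ≡ shift (shift^ i (deriv^ i d))
    shift^-+1 i = ≡.cong (λ k → shift^ k (deriv^ i d)) (ℕₚ.+-comm i 1)

  deriv-tS : deriv tS ≐ oneS
  deriv-tS zero    = trans (*-identityʳ _) (+-identityʳ 1#)
  deriv-tS (suc n) = zeroʳ _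

  Der-tS : ∀ a → Der (a , tS) ≐² (oneS , tS ⊛ a)
  Der-tS a = deriv-tS , ≐-refl

  Der²-tS : ∀ a → Der (Der (a , tS)) ≐² ((λ n → fromℕ (suc n) *R a n) , tS)
  Der²-tS a = ≐²-trans (Der-cong (Der-tS a))
    ( (λ n → *-congˡ (tS-⊛ a (suc n)))
    , ≐-trans (tS-⊛ oneS) (≐-sym tS≐shift-oneS))

  Der^-even : ∀ m d → Der^ (2 * m) (d , tS) ≐² (powerWeighted m d , tS)
  Der^-even zero    d = (λ n → sym (trans (*-congˡ (+-identityʳ 1#)) (*-identityʳ (d n)))) , ≐-refl
  Der^-even (suc m) d = begin
    Der^ (2 * suc m) (d , tS)                                ≡⟨ ≡.cong (λ k → Der^ k (d , tS)) (ℕₚ.*-suc 2 m) ⟩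
    Der (Der (Der^ (2 * m) (d , tS)))                        ≈⟨ Der-cong (Der-cong (Der^-even m d)) ⟩
    Der (Der (powerWeighted m d , tS))                       ≈⟨ Der²-tS (powerWeighted m d) ⟩
    ((λ n → fromℕ (suc n) *R powerWeighted m d n) , tS)      ≈⟨ powerWeighted-suc , ≐-refl ⟩
    (powerWeighted (suc m) d , tS)                           ∎
    where
    open SetoidReasoning ≐²-setoid
    powerWeighted-suc : (λ n → fromℕ (suc n) *R powerWeighted m d n) ≐ powerWeighted (suc m) d
    powerWeighted-suc n =
      trans (x∙yz≈y∙xz (fromℕ (suc n)) (d n) _) (*-congˡ (sym (fromℕ-homo-* (suc n) (suc n ^ m))))

  Der^-odd : ∀ m d → Der^ (2 * m + 1) (d , tS) ≐² (oneS , tS ⊛ powerWeighted m d)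
  Der^-odd m d = begin
    Der^ (2 * m + 1) (d , tS)          ≡⟨ ≡.cong (λ k → Der^ k (d , tS)) (ℕₚ.+-comm (2 * m) 1) ⟩
    Der (Der^ (2 * m) (d , tS))        ≈⟨ Der-cong (Der^-even m d) ⟩
    Der (powerWeighted m d , tS)       ≈⟨ Der-tS (powerWeighted m d) ⟩
    (oneS , tS ⊛ powerWeighted m d)    ∎
    where open SetoidReasoning ≐²-setoid

-- The hypothesis d₀ ≉ 0 only makes R(d, t) a Riordan array; the identities hold for every d.
theorem4p8 : ∀ {c ℓ : Level} (R : CommutativeRing c ℓ) →
    let open FPS R in (d : Series) → ¬ (d 0 ≈ 0#) → (m : ℕ) →
      (RiordanP (Der^ (2 * m) (d , tS))
          ≋ Riordan (sumS m (λ i → fromℕ (stirling₂ (m + 1) (i + 1)) · ((tS ^S i) ⊛ deriv^ i d))) tS)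
      × (Riordan (sumS m (λ i → fromℕ (stirling₂ (m + 1) (i + 1)) · ((tS ^S i) ⊛ deriv^ i d))) tS
          ≋ Riordan (λ i → d i *R fromℕ (suc i ^ m)) tS)
      × (RiordanP (Der^ (2 * m + 1) (d , tS))
          ≋ Riordan oneS (sumS m (λ i → fromℕ (stirling₂ (m + 1) (i + 1)) · ((tS ^S (i + 1)) ⊛ deriv^ i d))))
      × (Riordan oneS (sumS m (λ i → fromℕ (stirling₂ (m + 1) (i + 1)) · ((tS ^S (i + 1)) ⊛ deriv^ i d)))
          ≋ Riordan oneS (tS ⊛ (λ i → d i *R fromℕ (suc i ^ m))))
theorem4p8 R d _ m =
    RiordanP-cong (≐²-trans (Der^-even m d) (≐-sym (stirlingCombination-tS^ m d) , ≐-refl))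
  , Riordan-cong (stirlingCombination-tS^ m d) ≐-refl
  , RiordanP-cong (≐²-trans (Der^-odd m d) (≐-refl , ≐-sym (stirlingCombination-tS^-suc m d)))
  , Riordan-cong ≐-refl (stirlingCombination-tS^-suc m d)
  where open FPSProperties R
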